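{- Let $G$ be a subcubic graph of order $n$ with vertex set $V$, and let $D_1,D_2\subseteq V$ be two disjoint connected dominating sets in $G$. Then $|D_1|+|D_2|\ge n-2$, and each of the induced subgraphs $G[D_1]$ and $G[D_2]$ is a path or a cycle. If $|D_1|+|D_2|=n-2$, then $|D_1|=|D_2|=n/2-1$, both $G[D_1]$ and $G[D_2]$ are paths, and $D_1$ and $D_2$ are joined by a matching of size $n/2-1$ in $G$.
   Context: Graphs are finite and simple. A graph is subcubic if it is connected and its maximum vertex degree is at most 3. $G[S]$ denotes the subgraph induced by $S$. A set $D\subseteq V$ is dominating if every vertex of $V\setminus D$ has a neighbour in $D$; it is a connected dominating set if moreover $G[D]$ is connected. A single vertex counts as a path. -}

module Defs where

open import Data.Nat using (ℕ; zero; suc; _+_; _*_; _≤_)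
open import Data.Bool using (Bool; true; false)
open import Data.Fin using (Fin)
open import Data.Fin.Subset using (Subset; _∈_; _∉_; ∣_∣; Nonempty; ⊤)
open import Data.Vec using (tabulate)
open import Data.List using (List; []; _∷_; _++_; [_]; length; map)
import Data.List.Membership.Propositional as LM
open import Data.List.Relation.Unary.Unique.Propositional using (Unique)
open import Data.Product using (Σ; ∃; ∃-syntax; _×_; _,_; proj₁; proj₂)
open import Data.Sum using (_⊎_)
open import Relation.Binary.PropositionalEquality using (_≡_)
open import Function.Bundles using (_⇔_)

record Graph (n : ℕ) : Set where
  field
    adj     : Fin n → Fin n → Bool
    adj-sym : ∀ u v → adj u v ≡ adj v u
    irrefl  : ∀ v → adj v v ≡ false

module _ {n : ℕ} (G : Graph n) where
  open Graph G

  Adj : Fin n → Fin n → Set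
  Adj u v = adj u v ≡ true

  N : Fin n → Subset n
  N v = tabulate (adj v)

  degree : Fin n → ℕ
  degree v = ∣ N v ∣

  data Reach (S : Subset n) : Fin n → Fin n → Set where
    here : ∀ {u} → u ∈ S → Reach S u u
    step : ∀ {u w v} → u ∈ S → Adj u w → Reach S w v → Reach S u v

  ConnectedSet : Subset n → Set
  ConnectedSet S = Nonempty S × (∀ u v → u ∈ S → v ∈ S → Reach S u v)

  Connected : Set
  Connected = ConnectedSet ⊤

  Subcubic : Set
  Subcubic = Connected × (∀ v → degree v ≤ 3)

  Dominating : Subset n → Set
  Dominating D = ∀ v → v ∉ D → ∃[ u ] (u ∈ D × Adj u v)

  ConnectedDominating : Subset n → Set
  ConnectedDominating D = Dominating D × ConnectedSet D

  Disjoint : Subset n → Subset n → Set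
  Disjoint A B = ∀ v → v ∈ A → v ∉ B

  Consecutive : List (Fin n) → Fin n → Fin n → Set
  Consecutive vs u v = ∃[ xs ] ∃[ ys ]
    (vs ≡ xs ++ u ∷ v ∷ ys ⊎ vs ≡ xs ++ v ∷ u ∷ ys)

  CycConsecutive : List (Fin n) → Fin n → Fin n → Set
  CycConsecutive vs u v = Consecutive vs u v ⊎
    (∃[ xs ] (vs ≡ u ∷ xs ++ [ v ] ⊎ vs ≡ v ∷ xs ++ [ u ]))

  Enumerates : List (Fin n) → Subset n → Set
  Enumerates vs S = Unique vs × (∀ v → (v LM.∈ vs) ⇔ (v ∈ S))

  -- G[S] is isomorphic to a path (a single vertex counts as a path)
  IsPath : Subset n → Set
  IsPath S = ∃[ vs ] (Enumerates vs S × 1 ≤ length vs ×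
    (∀ u v → u ∈ S → v ∈ S → Adj u v ⇔ Consecutive vs u v))

  IsCycle : Subset n → Set
  IsCycle S = ∃[ vs ] (Enumerates vs S × 3 ≤ length vs ×
    (∀ u v → u ∈ S → v ∈ S → Adj u v ⇔ CycConsecutive vs u v))

  -- a matching given as a list of edges uv with u ∈ A, v ∈ B, pairwise vertex-disjoint
  MatchingBetween : Subset n → Subset n → List (Fin n × Fin n) → Set
  MatchingBetween A B M =
    (∀ e → e LM.∈ M → proj₁ e ∈ A × proj₂ e ∈ B × Adj (proj₁ e) (proj₂ e))
    × Unique (map proj₁ M) × Unique (map proj₂ M)

{-# OPTIONS --safe #-}
module Submission where

-- Every vertex of D₁ has a neighbour in D₂, so in a subcubic graph it has at most two
-- neighbours inside D₁; hence a maximal path of G[D₁], grown at both ends, is closed under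
-- adjacency in D₁ and, G[D₁] being connected, spans it, and G[D₁] is that path or a cycle.
-- Every vertex outside D₁ is adjacent to D₁; along the path the end vertices have at most
-- two neighbours outside D₁ and the others at most one, so n − |D₁| ≤ |D₁| + 2, with one
-- less if the ends are adjacent. Together with the same bound for D₂ this gives
-- n ≤ |D₁| + |D₂| + 2. In case of equality both bounds are attained: |D₁| = |D₂|, neither
-- G[Dᵢ] is a cycle, and no vertex outside D₁ is counted twice, so choosing a D₂-neighbour
-- for each vertex of D₁ gives distinct vertices, i.e. a matching.

open import Defs
open import Data.Nat using (ℕ; zero; suc; _+_; _*_; _≤_; _<_; z≤n; s≤s)
open import Data.Nat.Properties
open import Data.Nat.ListAction using (sum)
open import Data.Nat.Tactic.RingSolver using (solve-∀)
open import Data.Bool using (true)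
import Data.Bool.Properties as Bool
open import Data.Empty using (⊥-elim)
open import Data.Fin using (Fin)
open import Data.Fin.Properties using (any?) renaming (_≟_ to _≟ᶠ_)
open import Data.Fin.Subset using (Subset; _∈_; _∉_; _⊆_; ∣_∣; _∪_; _─_; _-_; ⁅_⁆; ⊥; ⋃; ∁; Nonempty; inside; outside)
open import Data.Fin.Subset.Properties
open import Data.Vec.Base using ([]; _∷_; here; there)
open import Data.Vec.Properties using (lookup∘tabulate; lookup⇒[]=)
open import Data.List using (List; []; _∷_; _++_; _∷ʳ_; [_]; length; map)
open import Data.List.Properties using (∷-injectiveˡ; ∷-injectiveʳ; ∷ʳ-injectiveʳ; ∷ʳ-++; length-++; length-++-≤ʳ; length-map; map-∘; map-id)
open import Data.List.Membership.Propositional using () renaming (_∈_ to _∈ₗ_; _∉_ to _∉ₗ_)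
open import Data.List.Membership.Propositional.Properties using (∈-++⁺ˡ; ∈-++⁺ʳ; ∈-map⁻)
open import Data.List.Relation.Binary.Subset.Propositional using () renaming (_⊆_ to _⊆ₗ_)
open import Data.List.Relation.Unary.Any using (here; there)
open import Data.List.Relation.Unary.All as All using (All; []; _∷_)
import Data.List.Relation.Unary.All.Properties as All
open import Data.List.Relation.Unary.AllPairs as AllPairs using ([]; _∷_)
open import Data.List.Relation.Unary.Linked as Linked using (Linked; []; [-]; _∷_)
open import Data.List.Relation.Unary.Unique.Propositional using (Unique)
open import Data.List.Relation.Unary.Unique.Propositional.Properties as Unique
  using (Unique[x∷xs]⇒x∉xs)
open import Data.Product using (∃; ∃₂; ∃-syntax; _×_; _,_; proj₁; proj₂; map₂)
open import Data.Sum as Sum using (_⊎_; inj₁; inj₂)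
open import Function using (_∘_; id)
open import Function.Bundles using (mk⇔)
open import Relation.Binary.Core using (Rel)
open import Relation.Binary.Definitions using (DecidableEquality)
open import Relation.Binary.PropositionalEquality hiding ([_])
open import Relation.Nullary using (¬_; Dec; yes; no; ¬?)
open import Relation.Nullary.Decidable using (_×-dec_; decidable-stable)

∣p∪q∣≤∣p∣+∣q∣ : ∀ {n} (p q : Subset n) → ∣ p ∪ q ∣ ≤ ∣ p ∣ + ∣ q ∣
∣p∪q∣≤∣p∣+∣q∣ []            []            = z≤n
∣p∪q∣≤∣p∣+∣q∣ (inside  ∷ p) (inside  ∷ q) = s≤s (≤-trans (∣p∪q∣≤∣p∣+∣q∣ p q) (+-monoʳ-≤ ∣ p ∣ (n≤1+n _)))
∣p∪q∣≤∣p∣+∣q∣ (inside  ∷ p) (outside ∷ q) = s≤s (∣p∪q∣≤∣p∣+∣q∣ p q)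
∣p∪q∣≤∣p∣+∣q∣ (outside ∷ p) (inside  ∷ q) rewrite +-suc ∣ p ∣ ∣ q ∣ = s≤s (∣p∪q∣≤∣p∣+∣q∣ p q)
∣p∪q∣≤∣p∣+∣q∣ (outside ∷ p) (outside ∷ q) = ∣p∪q∣≤∣p∣+∣q∣ p q

∣∁p∣+∣p∣≡n : ∀ {n} (p : Subset n) → ∣ ∁ p ∣ + ∣ p ∣ ≡ n
∣∁p∣+∣p∣≡n {n} p = trans (cong (_+ ∣ p ∣) (∣∁p∣≡n∸∣p∣ p)) (m∸n+n≡m (∣p∣≤n p))

x∈p─q⇒x∉q : ∀ {n} {x : Fin n} (p q : Subset n) → x ∈ p ─ q → x ∉ q
x∈p─q⇒x∉q (_ ∷ p) (outside ∷ q) here      ()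
x∈p─q⇒x∉q (_ ∷ p) (inside  ∷ q) ()        here
x∈p─q⇒x∉q (_ ∷ p) (_       ∷ q) (there i) (there j) = x∈p─q⇒x∉q p q i j

length+∣q∣≤∣p∣ : ∀ {n} {xs : List (Fin n)} {p q : Subset n} →
  Unique xs → All (_∈ p) xs → All (_∉ q) xs → q ⊆ p → length xs + ∣ q ∣ ≤ ∣ p ∣
length+∣q∣≤∣p∣ {xs = []} _ _ _ q⊆p = p⊆q⇒∣p∣≤∣q∣ q⊆p
length+∣q∣≤∣p∣ {xs = x ∷ xs} {p} {q} (x∉xs ∷ u) (x∈p ∷ xs⊆p) (x∉q ∷ xs∉q) q⊆p =
  ≤-trans (s≤s (length+∣q∣≤∣p∣ u xs⊆p-x xs∉q q⊆p-x)) (x∈p⇒∣p-x∣<∣p∣ x∈p)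
  where
  xs⊆p-x : All (_∈ p - x) xs
  xs⊆p-x = All.zipWith (λ (x≢y , y∈p) → x∈p∧x≢y⇒x∈p-y y∈p (x≢y ∘ sym)) (x∉xs , xs⊆p)
  q⊆p-x : q ⊆ p - x
  q⊆p-x y∈q = x∈p∧x≢y⇒x∈p-y (q⊆p y∈q) (λ { refl → x∉q y∈q })

length≤∣p∣ : ∀ {n} {xs : List (Fin n)} {p : Subset n} → Unique xs → All (_∈ p) xs → length xs ≤ ∣ p ∣
length≤∣p∣ {n} {xs} u xs⊆p =
  ≤-trans (m≤m+n (length xs) ∣ ⊥ {n} ∣) (length+∣q∣≤∣p∣ u xs⊆p (All.tabulate (λ _ → ∉⊥)) ⊥⊆)

module _ {A : Set} {n : ℕ} (T : A → Subset n) where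

  ∣⋃∣≤sum : ∀ as → ∣ ⋃ (map T as) ∣ ≤ sum (map (∣_∣ ∘ T) as)
  ∣⋃∣≤sum []       = ≤-reflexive (∣⊥∣≡0 n)
  ∣⋃∣≤sum (a ∷ as) = ≤-trans (∣p∪q∣≤∣p∣+∣q∣ (T a) _) (+-monoʳ-≤ ∣ T a ∣ (∣⋃∣≤sum as))

  ∈⋃ : ∀ {as a x} → a ∈ₗ as → x ∈ T a → x ∈ ⋃ (map T as)
  ∈⋃ {_ ∷ as} (here refl) x∈Ta = p⊆p∪q (⋃ (map T as)) x∈Ta
  ∈⋃ {b ∷ as} (there a∈)  x∈Ta = q⊆p∪q (T b) _ (∈⋃ a∈ x∈Ta)

  Covers : List A → Subset n → Set
  Covers as p = ∀ {x} → x ∈ p → ∃ λ a → a ∈ₗ as × x ∈ T a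

  covers⇒∣p∣≤sum : ∀ {as p} → Covers as p → ∣ p ∣ ≤ sum (map (∣_∣ ∘ T) as)
  covers⇒∣p∣≤sum {as} {p} cover = ≤-trans (p⊆q⇒∣p∣≤∣q∣ p⊆⋃) (∣⋃∣≤sum as)
    where
    p⊆⋃ : p ⊆ ⋃ (map T as)
    p⊆⋃ x∈p = let (a , a∈ , x∈Ta) = cover x∈p in ∈⋃ a∈ x∈Ta

∣p∣≤length : ∀ {n} {p : Subset n} {xs} → (∀ {x} → x ∈ p → x ∈ₗ xs) → ∣ p ∣ ≤ length xs
∣p∣≤length {xs = xs} p⊆xs =
  ≤-trans (covers⇒∣p∣≤sum ⁅_⁆ (λ x∈p → _ , p⊆xs x∈p , x∈⁅x⁆ _)) (≤-reflexive (sum-∣⁅⁆∣ xs))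
  where
  sum-∣⁅⁆∣ : ∀ xs → sum (map (∣_∣ ∘ ⁅_⁆) xs) ≡ length xs
  sum-∣⁅⁆∣ []       = refl
  sum-∣⁅⁆∣ (x ∷ xs) = cong₂ _+_ (∣⁅x⁆∣≡1 x) (sum-∣⁅⁆∣ xs)

module _ {A : Set} {f g : A → ℕ} (f≤g : ∀ a → f a ≤ g a) where

  sum-map-mono-≤ : ∀ as → sum (map f as) ≤ sum (map g as)
  sum-map-mono-≤ []       = z≤n
  sum-map-mono-≤ (a ∷ as) = +-mono-≤ (f≤g a) (sum-map-mono-≤ as)

  sum-map-mono-< : ∀ {as b} → b ∈ₗ as → f b < g b → sum (map f as) < sum (map g as)
  sum-map-mono-< {_ ∷ as} (here refl) fb<gb = +-mono-<-≤ fb<gb (sum-map-mono-≤ as)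
  sum-map-mono-< {a ∷ as} (there b∈)  fb<gb = +-mono-≤-< (f≤g a) (sum-map-mono-< b∈ fb<gb)

module _ {A : Set} (_≟_ : DecidableEquality A) {n : ℕ} (T : A → Subset n) where

  -- Removing y from T a′ still leaves a cover, since y is also covered by T a.
  covers-twice⇒∣p∣<sum : ∀ {as p a a′ y} → Covers T as p → a ∈ₗ as → a′ ∈ₗ as → a ≢ a′ →
    y ∈ T a → y ∈ T a′ → ∣ p ∣ < sum (map (∣_∣ ∘ T) as)
  covers-twice⇒∣p∣<sum {as} {p} {a} {a′} {y} cover a∈ a′∈ a≢a′ y∈Ta y∈Ta′ =
    ≤-<-trans (covers⇒∣p∣≤sum T′ cover′) (sum-map-mono-< T′≤T a′∈ T′a′<Ta′)
    where
    shrink : ∀ b → Dec (b ≡ a′) → Subset n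
    shrink b (yes _) = T b - y
    shrink b (no _)  = T b

    T′ : A → Subset n
    T′ b = shrink b (b ≟ a′)

    T′≤T : ∀ b → ∣ T′ b ∣ ≤ ∣ T b ∣
    T′≤T b with b ≟ a′
    ... | yes _ = ∣p─q∣≤∣p∣ (T b) ⁅ y ⁆
    ... | no _  = ≤-refl

    T′a′<Ta′ : ∣ T′ a′ ∣ < ∣ T a′ ∣
    T′a′<Ta′ with a′ ≟ a′
    ... | yes _    = x∈p⇒∣p-x∣<∣p∣ y∈Ta′
    ... | no a′≢a′ = ⊥-elim (a′≢a′ refl)

    ∈T′ : ∀ {b x} → x ∈ T b → (b ≡ a′ → x ≢ y) → x ∈ T′ b
    ∈T′ {b} x∈Tb x≢y with b ≟ a′
    ... | yes b≡a′ = x∈p∧x≢y⇒x∈p-y x∈Tb (x≢y b≡a′)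
    ... | no _     = x∈Tb

    cover′ : Covers T′ as p
    cover′ {x} x∈p with cover x∈p | x ≟ᶠ y
    ... | b , b∈ , x∈Tb | no x≢y = b , b∈ , ∈T′ x∈Tb (λ _ → x≢y)
    ... | _             | yes refl = a , a∈ , ∈T′ y∈Ta (λ a≡a′ _ → a≢a′ a≡a′)

module _ {A : Set} where

  data Position (xs : List A) (w : A) : Set where
    first    : ∀ bs → xs ≡ w ∷ bs → Position xs w
    last     : ∀ as → xs ≡ as ∷ʳ w → Position xs w
    interior : ∀ as p s bs → xs ≡ as ++ p ∷ w ∷ s ∷ bs → Position xs w

  position : ∀ {xs w} → w ∈ₗ xs → Position xs w
  position {x ∷ xs} (here refl) = first xs refl
  position {x ∷ xs} (there w∈) with position w∈
  ... | first []       refl       = last [ x ] refl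
  ... | first (s ∷ bs) refl       = interior [] x s bs refl
  ... | last as refl              = last (x ∷ as) refl
  ... | interior as p s bs refl   = interior (x ∷ as) p s bs refl

  snoc-view : ∀ (x : A) xs → ∃₂ λ as l → x ∷ xs ≡ as ∷ʳ l
  snoc-view x []       = [] , x , refl
  snoc-view x (y ∷ ys) = let (as , l , eq) = snoc-view y ys in x ∷ as , l , cong (x ∷_) eq

  []≢∷ʳ : ∀ {xs : List A} {x} → [] ≢ xs ∷ʳ x
  []≢∷ʳ {[]}    ()
  []≢∷ʳ {_ ∷ _} ()

  ends-injective : ∀ {x x′ y y′ : A} xs xs′ → x ∷ xs ∷ʳ y ≡ x′ ∷ xs′ ∷ʳ y′ → x ≡ x′ × y ≡ y′
  ends-injective xs xs′ eq = ∷-injectiveˡ eq , ∷ʳ-injectiveʳ (_ ∷ xs) (_ ∷ xs′) eq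

  unique-map⁺ : ∀ {B : Set} {f : A → B} {xs} → (∀ {x y} → x ∈ₗ xs → y ∈ₗ xs → f x ≡ f y → x ≡ y) →
    Unique xs → Unique (map f xs)
  unique-map⁺ {xs = []}     _   []           = []
  unique-map⁺ {xs = x ∷ xs} inj (x∉xs ∷ u) =
    All.map⁺ (All.tabulate λ y∈ fx≡fy → All.lookup x∉xs y∈ (inj (here refl) (there y∈) fx≡fy))
    ∷ unique-map⁺ (λ x∈ y∈ → inj (there x∈) (there y∈)) u

module _ {A : Set} {ℓ} {R : Rel A ℓ} where

  linked-∷ʳ⁺ : ∀ {xs as x y} → xs ≡ as ∷ʳ x → Linked R xs → R x y → Linked R (xs ∷ʳ y)
  linked-∷ʳ⁺ {as = []}          refl [-]       r = r ∷ [-]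
  linked-∷ʳ⁺ {as = _ ∷ []}      refl (r′ ∷ l) r = r′ ∷ linked-∷ʳ⁺ {as = []} refl l r
  linked-∷ʳ⁺ {as = _ ∷ a ∷ as}  refl (r′ ∷ l) r = r′ ∷ linked-∷ʳ⁺ {as = a ∷ as} refl l r

module GraphBasics {n : ℕ} (G : Graph n) where
  open Graph G

  Adj-sym : ∀ {u v} → Adj G u v → Adj G v u
  Adj-sym {u} {v} uv = trans (adj-sym v u) uv

  Adj-irrefl : ∀ {v} → ¬ Adj G v v
  Adj-irrefl {v} vv with trans (sym (irrefl v)) vv
  ... | ()

  Adj? : ∀ u v → Dec (Adj G u v)
  Adj? u v = adj u v Bool.≟ true

  Adj⇒∈N : ∀ {u v} → Adj G u v → v ∈ N G u
  Adj⇒∈N {u} {v} uv = lookup⇒[]= v (N G u) (trans (lookup∘tabulate (adj u) v) uv)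

  InducedDegree≤ : Subset n → ℕ → Set
  InducedDegree≤ S k = ∀ {x ps} → x ∈ S → Unique ps → All (_∈ S) ps → All (Adj G x) ps → length ps ≤ k

  ∣N─S∣+length≤degree : ∀ {S x ps} → Unique ps → All (_∈ S) ps → All (Adj G x) ps →
    ∣ N G x ─ S ∣ + length ps ≤ degree G x
  ∣N─S∣+length≤degree {S} {x} {ps} u ps⊆S ps⊆Nx = begin
    ∣ N G x ─ S ∣ + length ps  ≡⟨ +-comm ∣ N G x ─ S ∣ (length ps) ⟩
    length ps + ∣ N G x ─ S ∣  ≤⟨ length+∣q∣≤∣p∣ u (All.map Adj⇒∈N ps⊆Nx) ps∉N─S (p─q⊆p _ _) ⟩
    degree G x                 ∎
    where
    open ≤-Reasoning
    ps∉N─S : All (_∉ N G x ─ S) ps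
    ps∉N─S = All.map (λ y∈S y∈N─S → x∈p─q⇒x∉q (N G x) S y∈N─S y∈S) ps⊆S

  Consecutive-sym : ∀ {vs u v} → Consecutive G vs u v → Consecutive G vs v u
  Consecutive-sym (xs , ys , eq) = xs , ys , Sum.swap eq

  CycConsecutive-sym : ∀ {vs u v} → CycConsecutive G vs u v → CycConsecutive G vs v u
  CycConsecutive-sym = Sum.map Consecutive-sym (map₂ Sum.swap)

  Reach-source∈ : ∀ {S u v} → Reach G S u v → u ∈ S
  Reach-source∈ (here u∈S)     = u∈S
  Reach-source∈ (step u∈S _ _) = u∈S

module Paths {n : ℕ} (G : Graph n) (S : Subset n) where
  open GraphBasics G
  open import Data.List.Membership.DecPropositional (_≟ᶠ_ {n}) using () renaming (_∈?_ to _∈ₗ?_)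

  record Path (vs : List (Fin n)) : Set where
    field
      linked : Linked (Adj G) vs
      unique : Unique vs
      inS    : All (_∈ S) vs
  open Path

  [-]-path : ∀ {x} → x ∈ S → Path [ x ]
  [-]-path x∈S = record { linked = [-] ; unique = [] ∷ [] ; inS = x∈S ∷ [] }

  ∷-path : ∀ {h t y} → Path (h ∷ t) → y ∈ S → Adj G y h → y ∉ₗ h ∷ t → Path (y ∷ h ∷ t)
  ∷-path P y∈S yh y∉ = record
    { linked = yh ∷ linked P
    ; unique = All.¬Any⇒All¬ _ y∉ ∷ unique P
    ; inS    = y∈S ∷ inS P
    }

  ∷ʳ-path : ∀ {vs as l y} → Path vs → vs ≡ as ∷ʳ l → y ∈ S → Adj G l y → y ∉ₗ vs → Path (vs ∷ʳ y)
  ∷ʳ-path P eq y∈S ly y∉ = record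
    { linked = linked-∷ʳ⁺ eq (linked P) ly
    ; unique = Unique.++⁺ (unique P) ([] ∷ []) (λ { (y∈vs , here refl) → y∉ y∈vs })
    ; inS    = All.++⁺ (inS P) (y∈S ∷ [])
    }

  path-tail : ∀ {x vs} → Path (x ∷ vs) → Path vs
  path-tail P = record
    { linked = Linked.tail (linked P) ; unique = AllPairs.tail (unique P) ; inS = All.tail (inS P) }

  path-suffix : ∀ as {bs} → Path (as ++ bs) → Path bs
  path-suffix []       P = P
  path-suffix (_ ∷ as) P = path-suffix as (path-tail P)

  path-length≤∣S∣ : ∀ {vs} → Path vs → length vs ≤ ∣ S ∣
  path-length≤∣S∣ P = length≤∣p∣ (unique P) (inS P)

  consecutive⇒adj : ∀ {vs u v} → Path vs → Consecutive G vs u v → Adj G u v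
  consecutive⇒adj P (as , bs , inj₁ refl) = Linked.head (linked (path-suffix as P))
  consecutive⇒adj P (as , bs , inj₂ refl) = Adj-sym (Linked.head (linked (path-suffix as P)))

  ClosedAt : Fin n → List (Fin n) → Set
  ClosedAt x vs = ∀ {y} → y ∈ S → Adj G x y → y ∈ₗ vs

  Closed : List (Fin n) → Set
  Closed vs = ∀ {x} → x ∈ₗ vs → ClosedAt x vs

  Spans : List (Fin n) → Set
  Spans vs = ∀ {v} → v ∈ S → v ∈ₗ vs

  closed-reach : ∀ {vs u v} → Closed vs → Reach G S u v → u ∈ₗ vs → v ∈ₗ vs
  closed-reach closed (here _)        u∈ = u∈
  closed-reach closed (step _ uw w⇝v) u∈ = closed-reach closed w⇝v (closed u∈ (Reach-source∈ w⇝v) uw)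

  newNeighbour? : ∀ x vs → (∃ λ y → y ∈ S × Adj G x y × y ∉ₗ vs) ⊎ ClosedAt x vs
  newNeighbour? x vs with any? (λ y → y ∈? S ×-dec Adj? x y ×-dec ¬? (y ∈ₗ? vs))
  ... | yes found = inj₁ found
  ... | no none   = inj₂ λ {y} y∈S xy → decidable-stable (y ∈ₗ? vs) (λ y∉ → none (y , y∈S , xy , y∉))

  ClosingEdge : List (Fin n) → Set
  ClosingEdge vs = ∃[ x ] ∃[ m ] ∃[ mid ] ∃[ z ] (vs ≡ x ∷ m ∷ mid ∷ʳ z × Adj G x z)

  closingEdge? : ∀ vs → Dec (ClosingEdge vs)
  closingEdge? []           = no λ { (_ , _ , _ , _ , () , _) }
  closingEdge? (x ∷ [])     = no λ { (_ , _ , _ , _ , () , _) }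
  closingEdge? (x ∷ m ∷ []) = no λ (_ , _ , _ , _ , eq , _) → []≢∷ʳ (∷-injectiveʳ (∷-injectiveʳ eq))
  closingEdge? (x ∷ m ∷ k ∷ ks) with snoc-view k ks
  ... | mid , z , eq with Adj? x z
  ...   | yes xz = yes (x , m , mid , z , cong (λ r → x ∷ m ∷ r) eq , xz)
  ...   | no ¬xz = no λ (_ , _ , mid′ , _ , eq′ , x′z′) →
    let (x≡x′ , z≡z′) =
          ends-injective (m ∷ mid) (_ ∷ mid′) (trans (cong (λ r → x ∷ m ∷ r) (sym eq)) eq′)
    in ¬xz (subst₂ (Adj G) (sym x≡x′) (sym z≡z′) x′z′)

  module MaxDegree2 (degree≤2 : InducedDegree≤ S 2) where

    third-neighbour : ∀ {x p s y} → x ∈ S → p ∈ S → s ∈ S → y ∈ S → p ≢ s →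
      Adj G x p → Adj G x s → Adj G x y → y ≡ p ⊎ y ≡ s
    third-neighbour {p = p} {s} {y} x∈S p∈S s∈S y∈S p≢s xp xs xy with y ≟ᶠ p | y ≟ᶠ s
    ... | yes y≡p | _       = inj₁ y≡p
    ... | no _    | yes y≡s = inj₂ y≡s
    ... | no y≢p  | no y≢s  =
      ⊥-elim (1+n≰n (degree≤2 x∈S distinct (p∈S ∷ s∈S ∷ y∈S ∷ []) (xp ∷ xs ∷ xy ∷ [])))
      where
      distinct : Unique (_ ∷ _ ∷ _ ∷ [])
      distinct = (p≢s ∷ (y≢p ∘ sym) ∷ []) ∷ ((y≢s ∘ sym) ∷ []) ∷ [] ∷ []

    interior-neighbour : ∀ {vs as p w s bs y} → Path vs → vs ≡ as ++ p ∷ w ∷ s ∷ bs →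
      y ∈ S → Adj G w y → y ≡ p ⊎ y ≡ s
    interior-neighbour {as = as} P refl y∈S wy with path-suffix as P
    ... | record { linked = pw ∷ ws ∷ _ ; unique = (_ ∷ p≢s ∷ _) ∷ _ ; inS = p∈S ∷ w∈S ∷ s∈S ∷ _ } =
      third-neighbour w∈S p∈S s∈S y∈S p≢s (Adj-sym pw) ws wy

    interior-adj⇒consecutive : ∀ {vs as p u s bs v} → Path vs → vs ≡ as ++ p ∷ u ∷ s ∷ bs →
      v ∈ S → Adj G u v → Consecutive G vs u v
    interior-adj⇒consecutive {as = as} {p} {u} {s} {bs} P eq v∈S uv with interior-neighbour P eq v∈S uv
    ... | inj₁ refl = as , s ∷ bs , inj₂ eq
    ... | inj₂ refl = as ∷ʳ p , bs , inj₁ (trans eq (sym (∷ʳ-++ as p (u ∷ s ∷ bs))))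

    ends-adj⇒cycConsecutive : ∀ {u bs as v} → u ∷ bs ≡ as ∷ʳ v → Adj G u v → CycConsecutive G (u ∷ bs) u v
    ends-adj⇒cycConsecutive {u} {[]} {as} eq uv =
      ⊥-elim (Adj-irrefl (subst (Adj G u) (sym (∷ʳ-injectiveʳ [] as eq)) uv))
    ends-adj⇒cycConsecutive {u} {b ∷ bs} {as} eq uv =
      let (mid , z , b∷bs≡) = snoc-view b bs
          z≡v = ∷ʳ-injectiveʳ (u ∷ mid) as (trans (cong (u ∷_) (sym b∷bs≡)) eq)
      in inj₂ (mid , inj₁ (cong (u ∷_) (trans b∷bs≡ (cong (mid ∷ʳ_) z≡v))))

    -- An interior vertex already has its two S-neighbours on the path, so an edge between
    -- vertices of the path joins consecutive ones or the two ends.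
    path-adj⇒cycConsecutive : ∀ {vs u v} → Path vs → u ∈ₗ vs → v ∈ₗ vs → Adj G u v →
      CycConsecutive G vs u v
    path-adj⇒cycConsecutive P u∈ v∈ uv with position u∈ | position v∈
    ... | interior _ _ _ _ eq | _ = inj₁ (interior-adj⇒consecutive P eq (All.lookup (inS P) v∈) uv)
    ... | _ | interior _ _ _ _ eq =
      inj₁ (Consecutive-sym (interior-adj⇒consecutive P eq (All.lookup (inS P) u∈) (Adj-sym uv)))
    ... | first _ refl | last _ eq  = ends-adj⇒cycConsecutive eq uv
    ... | last _ eq    | first _ refl = CycConsecutive-sym (ends-adj⇒cycConsecutive eq (Adj-sym uv))
    ... | first _ refl | first _ eq =
      ⊥-elim (Adj-irrefl (subst (Adj G _) (sym (∷-injectiveˡ eq)) uv))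
    ... | last as refl | last as′ eq =
      ⊥-elim (Adj-irrefl (subst (Adj G _) (sym (∷ʳ-injectiveʳ as as′ eq)) uv))

    ends-closed⇒closed : ∀ {h t as l} → Path (h ∷ t) → h ∷ t ≡ as ∷ʳ l →
      ClosedAt h (h ∷ t) → ClosedAt l (h ∷ t) → Closed (h ∷ t)
    ends-closed⇒closed {h} {t} {as} {l} P eq h-closed l-closed {w} w∈ with position w∈
    ... | first _ eq′ = subst (λ x → ClosedAt x (h ∷ t)) (∷-injectiveˡ eq′) h-closed
    ... | last as′ eq′ =
      subst (λ x → ClosedAt x (h ∷ t)) (∷ʳ-injectiveʳ as as′ (trans (sym eq) eq′)) l-closed
    ... | interior as′ p s bs eq′ = λ y∈S wy → neighbour∈ (interior-neighbour P eq′ y∈S wy)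
      where
      neighbour∈ : ∀ {y} → y ≡ p ⊎ y ≡ s → y ∈ₗ h ∷ t
      neighbour∈ (inj₁ refl) = subst (p ∈ₗ_) (sym eq′) (∈-++⁺ʳ as′ (here refl))
      neighbour∈ (inj₂ refl) = subst (s ∈ₗ_) (sym eq′) (∈-++⁺ʳ as′ (there (there (here refl))))

    Extension : List (Fin n) → Set
    Extension vs = ∃ λ ws → Path ws × length ws ≡ suc (length vs) × vs ⊆ₗ ws

    extend-or-close : ∀ {vs} → Path vs → Extension vs ⊎ Closed vs
    extend-or-close {[]} _ = inj₂ λ ()
    extend-or-close {h ∷ t} P with newNeighbour? h (h ∷ t) | snoc-view h t
    ... | inj₁ (y , y∈S , hy , y∉) | _ =
      inj₁ (y ∷ h ∷ t , ∷-path P y∈S (Adj-sym hy) y∉ , refl , there)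
    ... | inj₂ h-closed | as , l , eq with newNeighbour? l (h ∷ t)
    ...   | inj₁ (y , y∈S , ly , y∉) =
      inj₁ ((h ∷ t) ∷ʳ y , ∷ʳ-path P eq y∈S ly y∉ , trans (length-++ (h ∷ t)) (+-comm _ 1) , ∈-++⁺ˡ)
    ...   | inj₂ l-closed = inj₂ (ends-closed⇒closed P eq h-closed l-closed)

    -- The fuel k suffices because a path has at most ∣ S ∣ vertices.
    grow : ∀ k {vs} → Path vs → ∣ S ∣ ≤ k + length vs → ∃ λ ws → Path ws × Closed ws × vs ⊆ₗ ws
    grow k P bound with extend-or-close P
    grow k       P bound | inj₂ closed = _ , P , closed , id
    grow zero    P bound | inj₁ (_ , P′ , len , _) =
      ⊥-elim (1+n≰n (≤-trans (subst (_≤ ∣ S ∣) len (path-length≤∣S∣ P′)) bound))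
    grow (suc k) P bound | inj₁ (_ , P′ , len , vs⊆ws) =
      let bound′ = subst (∣ S ∣ ≤_) (trans (sym (+-suc k _)) (cong (k +_) (sym len))) bound
          (us , P″ , closed , ws⊆us) = grow k P′ bound′
      in us , P″ , closed , λ v∈ → ws⊆us (vs⊆ws v∈)

    spanning-path : ConnectedSet G S → ∃ λ vs → Path vs × Spans vs
    spanning-path ((s , s∈S) , connected) =
      let (vs , P , closed , [s]⊆vs) = grow ∣ S ∣ ([-]-path s∈S) (m≤m+n ∣ S ∣ 1)
      in vs , P , λ v∈S → closed-reach closed (connected s _ s∈S v∈S) ([s]⊆vs (here refl))

    enumerates : ∀ {vs} → Path vs → Spans vs → Enumerates G vs S
    enumerates P spans = unique P , λ v → mk⇔ (All.lookup (inS P)) spans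

    path⇒isCycle : ∀ {vs} → Path vs → Spans vs → ClosingEdge vs → IsCycle G S
    path⇒isCycle P spans (x , m , mid , z , refl , xz) =
      _ , enumerates P spans , s≤s (s≤s (length-++-≤ʳ [ z ] {mid})) ,
      λ u v u∈S v∈S → mk⇔ (path-adj⇒cycConsecutive P (spans u∈S) (spans v∈S)) cyc⇒adj
      where
      cyc⇒adj : ∀ {u v} → CycConsecutive G (x ∷ m ∷ mid ∷ʳ z) u v → Adj G u v
      cyc⇒adj (inj₁ c) = consecutive⇒adj P c
      cyc⇒adj (inj₂ (mid′ , inj₁ eq)) =
        let (x≡u , z≡v) = ends-injective (m ∷ mid) mid′ eq in subst₂ (Adj G) x≡u z≡v xz
      cyc⇒adj (inj₂ (mid′ , inj₂ eq)) =
        let (x≡v , z≡u) = ends-injective (m ∷ mid) mid′ eq in subst₂ (Adj G) z≡u x≡v (Adj-sym xz)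

    path⇒isPath : ∀ {vs} → Path vs → Spans vs → Nonempty S → ¬ ClosingEdge vs → IsPath G S
    path⇒isPath {vs} P spans (s , s∈S) open-ends =
      vs , enumerates P spans , nonempty (spans s∈S) ,
      λ u v u∈S v∈S →
        mk⇔ (λ uv → cyc⇒consecutive uv (path-adj⇒cycConsecutive P (spans u∈S) (spans v∈S) uv))
            (consecutive⇒adj P)
      where
      nonempty : ∀ {xs : List (Fin n)} → s ∈ₗ xs → 1 ≤ length xs
      nonempty (here _)  = s≤s z≤n
      nonempty (there _) = s≤s z≤n
      cyc⇒consecutive : ∀ {u v} → Adj G u v → CycConsecutive G vs u v → Consecutive G vs u v
      cyc⇒consecutive uv (inj₁ c)                 = c
      cyc⇒consecutive uv (inj₂ ([] , inj₁ eq))    = [] , [] , inj₁ eq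
      cyc⇒consecutive uv (inj₂ ([] , inj₂ eq))    = [] , [] , inj₂ eq
      cyc⇒consecutive uv (inj₂ (m ∷ mid , inj₁ eq)) =
        ⊥-elim (open-ends (_ , m , mid , _ , eq , uv))
      cyc⇒consecutive uv (inj₂ (m ∷ mid , inj₂ eq)) =
        ⊥-elim (open-ends (_ , m , mid , _ , eq , Adj-sym uv))

  module MaxDegree3 (cubic : ∀ v → degree G v ≤ 3) where

    outer : Fin n → ℕ
    outer x = ∣ N G x ─ S ∣

    outer≤3 : ∀ x → outer x ≤ 3
    outer≤3 x = ≤-trans (∣p─q∣≤∣p∣ (N G x) S) (cubic x)

    outer+length≤3 : ∀ {x ps} → Unique ps → All (_∈ S) ps → All (Adj G x) ps → outer x + length ps ≤ 3
    outer+length≤3 {x} u ps⊆S ps⊆Nx = ≤-trans (∣N─S∣+length≤degree u ps⊆S ps⊆Nx) (cubic x)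

    outer≤2 : ∀ {x y} → y ∈ S → Adj G x y → outer x ≤ 2
    outer≤2 {x} y∈S xy = +-cancelʳ-≤ 1 (outer x) 2 (outer+length≤3 ([] ∷ []) (y∈S ∷ []) (xy ∷ []))

    outer≤1 : ∀ {x y z} → y ∈ S → z ∈ S → y ≢ z → Adj G x y → Adj G x z → outer x ≤ 1
    outer≤1 {x} y∈S z∈S y≢z xy xz =
      +-cancelʳ-≤ 2 (outer x) 1 (outer+length≤3 ((y≢z ∷ []) ∷ [] ∷ []) (y∈S ∷ z∈S ∷ []) (xy ∷ xz ∷ []))

    sum-outer≤1+length-after : ∀ {p w ws} → p ∈ S → p ∉ₗ w ∷ ws → Adj G p w → Path (w ∷ ws) →
      sum (map outer (w ∷ ws)) ≤ 1 + length (w ∷ ws)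
    sum-outer≤1+length-after {w = w} {[]} p∈S _ pw _ =
      subst (_≤ 2) (sym (+-identityʳ (outer w))) (outer≤2 p∈S (Adj-sym pw))
    sum-outer≤1+length-after {p} {w} {w′ ∷ ws} p∈S p∉ pw P =
      +-mono-≤ (outer≤1 p∈S w′∈S p≢w′ (Adj-sym pw) ww′)
               (sum-outer≤1+length-after w∈S w∉ ww′ (path-tail P))
      where
      ww′ : Adj G w w′
      ww′ = Linked.head (linked P)
      w∈S : w ∈ S
      w∈S = All.head (inS P)
      w′∈S : w′ ∈ S
      w′∈S = All.head (All.tail (inS P))
      w∉ : w ∉ₗ w′ ∷ ws
      w∉ = Unique[x∷xs]⇒x∉xs (unique P)
      p≢w′ : p ≢ w′
      p≢w′ refl = p∉ (there (here refl))

    sum-outer≤2+length : ∀ {vs} → Path vs → sum (map outer vs) ≤ 2 + length vs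
    sum-outer≤2+length {[]}         _ = z≤n
    sum-outer≤2+length {h ∷ []}     _ = subst (_≤ 3) (sym (+-identityʳ (outer h))) (outer≤3 h)
    sum-outer≤2+length {h ∷ w ∷ ws} P =
      +-mono-≤ (outer≤2 (All.head (All.tail (inS P))) hw)
               (sum-outer≤1+length-after (All.head (inS P)) (Unique[x∷xs]⇒x∉xs (unique P)) hw
                                         (path-tail P))
      where
      hw : Adj G h w
      hw = Linked.head (linked P)

    closing⇒sum-outer≤1+length : ∀ {vs} → Path vs → ClosingEdge vs → sum (map outer vs) ≤ 1 + length vs
    closing⇒sum-outer≤1+length P (x , m , mid , z , refl , xz) =
      +-mono-≤ (outer≤1 m∈S z∈S m≢z xm xz)
               (sum-outer≤1+length-after (All.head (inS P)) (Unique[x∷xs]⇒x∉xs (unique P)) xm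
                                         (path-tail P))
      where
      xm : Adj G x m
      xm = Linked.head (linked P)
      z∈mid∷ʳz : z ∈ₗ mid ∷ʳ z
      z∈mid∷ʳz = ∈-++⁺ʳ mid (here refl)
      m∈S : m ∈ S
      m∈S = All.head (All.tail (inS P))
      z∈S : z ∈ S
      z∈S = All.lookup (inS P) (there (there z∈mid∷ʳz))
      m≢z : m ≢ z
      m≢z refl = Unique[x∷xs]⇒x∉xs (AllPairs.tail (unique P)) z∈mid∷ʳz

2[m+1]≡2+m+m : ∀ m → 2 * (m + 1) ≡ 2 + m + m
2[m+1]≡2+m+m = solve-∀

c+m≡n∧c≤2+m⇒n≤2[m+1] : ∀ {c m n} → c + m ≡ n → c ≤ 2 + m → n ≤ 2 * (m + 1)
c+m≡n∧c≤2+m⇒n≤2[m+1] {m = m} refl c≤ =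
  ≤-trans (+-monoˡ-≤ m c≤) (≤-reflexive (sym (2[m+1]≡2+m+m m)))

c+m≡n∧c≤1+m⇒n<2[m+1] : ∀ {c m n} → c + m ≡ n → c ≤ 1 + m → n < 2 * (m + 1)
c+m≡n∧c≤1+m⇒n<2[m+1] {m = m} refl c≤ =
  ≤-trans (s≤s (+-monoˡ-≤ m c≤)) (≤-reflexive (sym (2[m+1]≡2+m+m m)))

n≤2[a+1]∧n≤2[b+1]⇒n≤a+b+2 : ∀ {n} a b → n ≤ 2 * (a + 1) → n ≤ 2 * (b + 1) → n ≤ a + b + 2
n≤2[a+1]∧n≤2[b+1]⇒n≤a+b+2 {n} a b n≤₁ n≤₂ = *-cancelˡ-≤ 2 (begin
  2 * n                      ≡⟨ cong (n +_) (+-identityʳ n) ⟩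
  n + n                      ≤⟨ +-mono-≤ n≤₁ n≤₂ ⟩
  2 * (a + 1) + 2 * (b + 1)  ≡⟨ distrib a b ⟩
  2 * (a + b + 2)            ∎)
  where
  open ≤-Reasoning
  distrib : ∀ a b → 2 * (a + 1) + 2 * (b + 1) ≡ 2 * (a + b + 2)
  distrib = solve-∀

a+b+2≤2[b+1]⇒a≤b : ∀ {a b} → a + b + 2 ≤ 2 * (b + 1) → a ≤ b
a+b+2≤2[b+1]⇒a≤b {a} {b} ≤₂ = +-cancelʳ-≤ (b + 2) a b (subst₂ _≤_ (assoc a b) (double b) ≤₂)
  where
  assoc : ∀ a b → a + b + 2 ≡ a + (b + 2)
  assoc = solve-∀
  double : ∀ b → 2 * (b + 1) ≡ b + (b + 2)
  double = solve-∀

a+b+2≡n⇒2[a+1]≡n : ∀ {n} a b → a + b + 2 ≡ n → n ≤ 2 * (a + 1) → n ≤ 2 * (b + 1) → 2 * (a + 1) ≡ n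
a+b+2≡n⇒2[a+1]≡n a b refl ≤₁ ≤₂ = begin
  2 * (a + 1)  ≡⟨ 2[m+1]≡2+m+m a ⟩
  2 + a + a    ≡⟨ cong (2 + a +_) a≡b ⟩
  2 + a + b    ≡⟨ +-comm 2 (a + b) ⟩
  a + b + 2    ∎
  where
  open ≡-Reasoning
  a≡b : a ≡ b
  a≡b = ≤-antisym (a+b+2≤2[b+1]⇒a≤b ≤₂)
                  (a+b+2≤2[b+1]⇒a≤b (subst (_≤ 2 * (a + 1)) (cong (_+ 2) (+-comm a b)) ≤₁))

module ConnectedDominatingSet {n : ℕ} (G : Graph n) (cubic : ∀ v → degree G v ≤ 3) (D D′ : Subset n)
  (dominating : Dominating G D) (connected : ConnectedSet G D)
  (dominating′ : Dominating G D′) (disjoint : Disjoint G D D′) where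

  open GraphBasics G
  open Paths G D
  open MaxDegree3 cubic

  -- Only meaningful off D′, in particular on D.
  partner : Fin n → Fin n
  partner a with a ∈? D′
  ... | yes _    = a
  ... | no a∉D′ = proj₁ (dominating′ a a∉D′)

  partner-adj : ∀ {a} → a ∈ D → partner a ∈ D′ × Adj G (partner a) a
  partner-adj {a} a∈D with a ∈? D′
  ... | yes a∈D′ = ⊥-elim (disjoint a a∈D a∈D′)
  ... | no a∉D′  = proj₂ (dominating′ a a∉D′)

  partner∈N─D : ∀ {a} → a ∈ D → partner a ∈ N G a ─ D
  partner∈N─D a∈D =
    let (b∈D′ , ba) = partner-adj a∈D
    in x∈p∧x∉q⇒x∈p─q (Adj⇒∈N (Adj-sym ba)) (λ b∈D → disjoint _ b∈D b∈D′)

  D-degree≤2 : InducedDegree≤ D 2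
  D-degree≤2 {a} {ps} a∈D u ps⊆D ps⊆Na =
    +-cancelˡ-≤ 1 (length ps) 2 (≤-trans (+-monoˡ-≤ (length ps) 1≤outer) (outer+length≤3 u ps⊆D ps⊆Na))
    where
    1≤outer : 1 ≤ outer a
    1≤outer = ≤-trans (s≤s z≤n) (x∈p⇒∣p-x∣<∣p∣ (partner∈N─D a∈D))

  open MaxDegree2 D-degree≤2

  spanning : ∃ λ vs → Path vs × Spans vs
  spanning = spanning-path connected

  vs : List (Fin n)
  vs = proj₁ spanning

  path : Path vs
  path = proj₁ (proj₂ spanning)

  spans : Spans vs
  spans = proj₂ (proj₂ spanning)

  length≡∣D∣ : length vs ≡ ∣ D ∣
  length≡∣D∣ = ≤-antisym (path-length≤∣S∣ path) (∣p∣≤length spans)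

  ∁D-covered : Covers (λ a → N G a ─ D) vs (∁ D)
  ∁D-covered {x} x∈∁D with dominating x (x∈∁p⇒x∉p x∈∁D)
  ... | a , a∈D , ax = a , spans a∈D , x∈p∧x∉q⇒x∈p─q (Adj⇒∈N ax) (x∈∁p⇒x∉p x∈∁D)

  ∣∁D∣≤2+∣D∣ : ∣ ∁ D ∣ ≤ 2 + ∣ D ∣
  ∣∁D∣≤2+∣D∣ = begin
    ∣ ∁ D ∣             ≤⟨ covers⇒∣p∣≤sum _ ∁D-covered ⟩
    sum (map outer vs)  ≤⟨ sum-outer≤2+length path ⟩
    2 + length vs       ≡⟨ cong (2 +_) length≡∣D∣ ⟩
    2 + ∣ D ∣           ∎
    where open ≤-Reasoning

  closing⇒∣∁D∣≤1+∣D∣ : ClosingEdge vs → ∣ ∁ D ∣ ≤ 1 + ∣ D ∣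
  closing⇒∣∁D∣≤1+∣D∣ closing = begin
    ∣ ∁ D ∣             ≤⟨ covers⇒∣p∣≤sum _ ∁D-covered ⟩
    sum (map outer vs)  ≤⟨ closing⇒sum-outer≤1+length path closing ⟩
    1 + length vs       ≡⟨ cong (1 +_) length≡∣D∣ ⟩
    1 + ∣ D ∣           ∎
    where open ≤-Reasoning

  n≤2[∣D∣+1] : n ≤ 2 * (∣ D ∣ + 1)
  n≤2[∣D∣+1] = c+m≡n∧c≤2+m⇒n≤2[m+1] (∣∁p∣+∣p∣≡n D) ∣∁D∣≤2+∣D∣

  not-tight : ∣ ∁ D ∣ ≤ 1 + ∣ D ∣ → 2 * (∣ D ∣ + 1) ≢ n
  not-tight ∣∁D∣≤ tight = <-irrefl (sym tight) (c+m≡n∧c≤1+m⇒n<2[m+1] (∣∁p∣+∣p∣≡n D) ∣∁D∣≤)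

  isPath⊎closingEdge : IsPath G D ⊎ ClosingEdge vs
  isPath⊎closingEdge with closingEdge? vs
  ... | yes closing  = inj₂ closing
  ... | no open-ends = inj₁ (path⇒isPath path spans (proj₁ connected) open-ends)

  pathOrCycle : IsPath G D ⊎ IsCycle G D
  pathOrCycle = Sum.map₂ (path⇒isCycle path spans) isPath⊎closingEdge

  tight⇒path : 2 * (∣ D ∣ + 1) ≡ n → IsPath G D
  tight⇒path tight with isPath⊎closingEdge
  ... | inj₁ isPath  = isPath
  ... | inj₂ closing = ⊥-elim (not-tight (closing⇒∣∁D∣≤1+∣D∣ closing) tight)

  partner-injective : 2 * (∣ D ∣ + 1) ≡ n →
    ∀ {a a′} → a ∈ₗ vs → a′ ∈ₗ vs → partner a ≡ partner a′ → a ≡ a′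
  partner-injective tight {a} {a′} a∈ a′∈ same with a ≟ᶠ a′
  ... | yes a≡a′ = a≡a′
  ... | no a≢a′  = ⊥-elim (not-tight (≤-pred ∣∁D∣<2+∣D∣) tight)
    where
    shared : partner a′ ∈ N G a ─ D
    shared = subst (_∈ N G a ─ D) same (partner∈N─D (All.lookup (Path.inS path) a∈))
    ∣∁D∣<2+∣D∣ : ∣ ∁ D ∣ < 2 + ∣ D ∣
    ∣∁D∣<2+∣D∣ = begin-strict
      ∣ ∁ D ∣             <⟨ covers-twice⇒∣p∣<sum _≟ᶠ_ _ ∁D-covered a∈ a′∈ a≢a′ shared
                               (partner∈N─D (All.lookup (Path.inS path) a′∈)) ⟩
      sum (map outer vs)  ≤⟨ sum-outer≤2+length path ⟩
      2 + length vs       ≡⟨ cong (2 +_) length≡∣D∣ ⟩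
      2 + ∣ D ∣           ∎
      where open ≤-Reasoning

  tight⇒matching : 2 * (∣ D ∣ + 1) ≡ n → ∃[ M ] (MatchingBetween G D D′ M × 2 * (length M + 1) ≡ n)
  tight⇒matching tight = M , (edges , unique₁ , unique₂) , trans (cong (λ k → 2 * (k + 1)) ∣M∣≡∣D∣) tight
    where
    M : List (Fin n × Fin n)
    M = map (λ a → a , partner a) vs
    ∣M∣≡∣D∣ : length M ≡ ∣ D ∣
    ∣M∣≡∣D∣ = trans (length-map _ vs) length≡∣D∣
    edges : ∀ e → e ∈ₗ M → proj₁ e ∈ D × proj₂ e ∈ D′ × Adj G (proj₁ e) (proj₂ e)
    edges _ e∈ with ∈-map⁻ _ e∈
    ... | a , a∈ , refl =
      let a∈D = All.lookup (Path.inS path) a∈ ; (b∈D′ , ba) = partner-adj a∈D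
      in a∈D , b∈D′ , Adj-sym ba
    unique₁ : Unique (map proj₁ M)
    unique₁ = subst Unique (trans (sym (map-id vs)) (map-∘ vs)) (Path.unique path)
    unique₂ : Unique (map proj₂ M)
    unique₂ = subst Unique (map-∘ vs) (unique-map⁺ (partner-injective tight) (Path.unique path))

corollary1 : ∀ {n : ℕ} (G : Graph n) (D₁ D₂ : Subset n) →
    Subcubic G → ConnectedDominating G D₁ → ConnectedDominating G D₂ →
    Disjoint G D₁ D₂ →
    (n ≤ ∣ D₁ ∣ + ∣ D₂ ∣ + 2)
    × (IsPath G D₁ ⊎ IsCycle G D₁)
    × (IsPath G D₂ ⊎ IsCycle G D₂)
    × (∣ D₁ ∣ + ∣ D₂ ∣ + 2 ≡ n →
        (2 * (∣ D₁ ∣ + 1) ≡ n) × (2 * (∣ D₂ ∣ + 1) ≡ n)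
        × IsPath G D₁ × IsPath G D₂
        × ∃[ M ] (MatchingBetween G D₁ D₂ M × 2 * (length M + 1) ≡ n))
corollary1 G D₁ D₂ (_ , cubic) (dominating₁ , connected₁) (dominating₂ , connected₂) disjoint =
  n≤2[a+1]∧n≤2[b+1]⇒n≤a+b+2 ∣ D₁ ∣ ∣ D₂ ∣ Side₁.n≤2[∣D∣+1] Side₂.n≤2[∣D∣+1] ,
  Side₁.pathOrCycle , Side₂.pathOrCycle ,
  λ sum≡n →
    let tight₁ = a+b+2≡n⇒2[a+1]≡n ∣ D₁ ∣ ∣ D₂ ∣ sum≡n Side₁.n≤2[∣D∣+1] Side₂.n≤2[∣D∣+1]
        tight₂ = a+b+2≡n⇒2[a+1]≡n ∣ D₂ ∣ ∣ D₁ ∣ (trans (cong (_+ 2) (+-comm ∣ D₂ ∣ ∣ D₁ ∣)) sum≡n)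
                   Side₂.n≤2[∣D∣+1] Side₁.n≤2[∣D∣+1]
    in tight₁ , tight₂ , Side₁.tight⇒path tight₁ , Side₂.tight⇒path tight₂ , Side₁.tight⇒matching tight₁
  where
  module Side₁ = ConnectedDominatingSet G cubic D₁ D₂ dominating₁ connected₁ dominating₂ disjoint
  module Side₂ = ConnectedDominatingSet G cubic D₂ D₁ dominating₂ connected₂ dominating₁
                   (λ v v∈D₂ v∈D₁ → disjoint v v∈D₁ v∈D₂)
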